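{- For $N\ge1$ and integers $\Sigma_1,\Sigma_2\ge0$, $n\ge1$, let $a_N(\Sigma_1,\Sigma_2;n)$ be the number of partitions of $n$ with exactly $N$ positive parts, in which every part occurs at most twice, and whose alternating sum type (modulus $3$) is $(\Sigma_1,\Sigma_2)$. Let $A_0=1$, $A_N(x,y,q)=\sum_{\Sigma_1,\Sigma_2\ge0}\sum_{n\ge1}a_N(\Sigma_1,\Sigma_2;n)x^{\Sigma_1}y^{\Sigma_2}q^n$ for $N\ge1$, and $P_N(x,y,q)=\sum_{i=0}^{N}A_i(x,y,q)$. Then $$P_0=1,\qquad P_1=\frac{1}{1-xq},\qquad P_2=\frac{1}{(1-xq)(1-yq^2)},$$ and for all $N\ge1$, $$P_{3N}=P_{3N-1}\frac{1}{1-q^{3N}}-P_{3N-3}\frac{q^{3N}}{1-q^{3N}},$$ $$P_{3N+1}=P_{3N}\frac{1}{1-xq^{3N+1}}-P_{3N-2}\frac{xq^{3N+1}}{1-xq^{3N+1}},$$ $$P_{3N+2}=P_{3N+1}\frac{1}{1-yq^{3N+2}}-P_{3N-1}\frac{yq^{3N+2}}{1-yq^{3N+2}}.$$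
   Context: For a partition $\lambda_1\ge\dots\ge\lambda_r>0$, append zero parts so that its length becomes a multiple $3k$ of $3$. Its alternating sum type (modulus 3) is $(\Sigma_1,\Sigma_2)$ with $\Sigma_1=\sum_{i=1}^k(\lambda_{3i-2}-\lambda_{3i-1})$ and $\Sigma_2=\sum_{i=1}^k(\lambda_{3i-1}-\lambda_{3i})$. All series are formal power series (or convergent for $|x|,|y|,|q|<1$). -}

module Defs where

open import Data.Bool using (Bool; true; false; _∧_; not; if_then_else_)
open import Data.Nat using (ℕ; zero; suc; _+_; _*_; _∸_; _≡ᵇ_; _≤ᵇ_)
open import Data.Nat.DivMod using (_/_; _%_)
open import Data.Integer as ℤ using (ℤ; +_)
open import Data.List using (List; []; _∷_; map; concatMap; upTo; length; filterᵇ; foldr)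
open import Data.Product using (_×_; _,_)
open import Relation.Binary.PropositionalEquality using (_≡_)

lists : ℕ → ℕ → List (List ℕ)
lists zero    m = [] ∷ []
lists (suc N) m = concatMap (λ v → map (v ∷_) (lists N m)) (map suc (upTo m))

nonincr : List ℕ → Bool
nonincr (a ∷ b ∷ l) = (b ≤ᵇ a) ∧ nonincr (b ∷ l)
nonincr _ = true

-- for a weakly decreasing list: every part occurs at most twice
atMostTwice : List ℕ → Bool
atMostTwice (a ∷ b ∷ c ∷ l) = not ((a ≡ᵇ b) ∧ (b ≡ᵇ c)) ∧ atMostTwice (b ∷ c ∷ l)
atMostTwice _ = true

sumL : List ℕ → ℕ
sumL = foldr _+_ 0

-- alternating sum type (modulus 3), zero parts appended to reach length 3k;
-- valid (no truncation in ∸) for weakly decreasing lists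
altType : List ℕ → ℕ × ℕ
altType []          = 0 , 0
altType (a ∷ [])    = a , 0
altType (a ∷ b ∷ []) = a ∸ b , b
altType (a ∷ b ∷ c ∷ l) with altType l
... | s , t = (a ∸ b) + s , (b ∸ c) + t

count : {A : Set} → (A → Bool) → List A → ℕ
count p l = length (filterᵇ p l)

aN : ℕ → ℕ → ℕ → ℕ → ℕ
aN N s1 s2 n = count good (lists N n)
  where
  good : List ℕ → Bool
  good l with altType l
  ... | u , v = nonincr l ∧ atMostTwice l ∧ (sumL l ≡ᵇ n) ∧ (u ≡ᵇ s1) ∧ (v ≡ᵇ s2)

-- Formal power series in x, y, q with integer coefficients:
-- f i j n is the coefficient of x^i y^j q^n.

Series : Set
Series = ℕ → ℕ → ℕ → ℤ

_≋_ : Series → Series → Set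
f ≋ g = ∀ i j n → f i j n ≡ g i j n
infix 4 _≋_

mono : ℕ → ℕ → ℕ → Series
mono a b c i j n = if (i ≡ᵇ a) ∧ (j ≡ᵇ b) ∧ (n ≡ᵇ c) then + 1 else + 0

one : Series
one = mono 0 0 0

_⊕_ : Series → Series → Series
(f ⊕ g) i j n = f i j n ℤ.+ g i j n

_⊖_ : Series → Series → Series
(f ⊖ g) i j n = f i j n ℤ.- g i j n

sumZ : List ℤ → ℤ
sumZ = foldr ℤ._+_ (+ 0)

_⊛_ : Series → Series → Series
(f ⊛ g) i j n =
  sumZ (concatMap (λ a → concatMap (λ b → map (λ c →
        f a b c ℤ.* g (i ∸ a) (j ∸ b) (n ∸ c))
      (upTo (suc n))) (upTo (suc j))) (upTo (suc i)))

infixl 7 _⊛_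
infixl 6 _⊕_ _⊖_

-- geom a b c = 1/(1 - x^a y^b q^c) = Σ_k x^{ka} y^{kb} q^{kc}, for c ≥ 1.
-- (The case c = 0 is never used; it is given the junk value 0.)
geom : ℕ → ℕ → ℕ → Series
geom a b zero    i j n = + 0
geom a b (suc c) i j n =
  if (n % suc c ≡ᵇ 0) ∧ (i ≡ᵇ (n / suc c) * a) ∧ (j ≡ᵇ (n / suc c) * b)
  then + 1 else + 0

A : ℕ → Series
A zero          = one
A (suc N) i j zero    = + 0
A (suc N) i j (suc n) = + aN (suc N) i j (suc n)

P : ℕ → Series
P zero    = A zero
P (suc N) = P N ⊕ A (suc N)

-- Subtracting 1 from every part of a partition into m parts, each occurring at most
-- twice, and deleting the (at most two) parts that become 0 is a bijection onto such
-- partitions into m, m - 1 or m - 2 parts; it lowers n by m and the alternating sum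
-- type by the type (a, b) of m ones, which is (0,0), (1,0), (0,1) for m = 0, 1, 2 mod 3.
-- With X = x^a y^b q^m this gives A_m = X (A_m + A_(m-1) + A_(m-2)) = X (P_m - P_(m-3)),
-- i.e. (1 - X) P_m = P_(m-1) - X P_(m-3).  Dividing by 1 - X is legitimate because
-- h = Q + X h has the unique solution Q / (1 - X): the coefficient of q^n on the right
-- only involves coefficients of h at q^(n - m).
module Submission where

open import Defs
open import Data.Bool using (Bool; true; false; _∧_; not; if_then_else_; T; T?)
open import Data.Bool.Properties using (T-∧; ∧-comm; ∧-assoc; ∧-zeroʳ)
open import Data.Empty using (⊥)
open import Data.Integer using (ℤ; +_) renaming (_+_ to _+ᶻ_; _-_ to _-ᶻ_; _*_ to _*ᶻ_)
import Data.Integer.Properties as ℤₚ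
open import Data.Integer.Solver using (module +-*-Solver)
open import Data.List as List
  using (List; []; _∷_; map; concatMap; upTo; _++_; [_]; length; replicate; filterᵇ; cartesianProductWith)
open import Data.List.Properties
  using (upTo-∷ʳ; map-++; ++-assoc; ++-identityʳ; length-++; length-map; length-replicate; map-∘; map-id-local;
         filter-++; filter-none; ∷-injective)
open import Data.List.Membership.Propositional using (_∈_)
open import Data.List.Membership.Propositional.Properties
  using (∈-map⁺; ∈-map⁻; ∈-filter⁺; ∈-filter⁻; ∈-upTo⁺; ∈-++⁺ˡ; ∈-++⁺ʳ; ∈-++⁻;
         ∈-cartesianProductWith⁺; ∈-cartesianProductWith⁻)
open import Data.List.Membership.Propositional.Properties.WithK using (unique∧set⇒bag)
open import Data.List.Relation.Binary.BagAndSetEquality using (∼bag⇒↭)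
open import Data.List.Relation.Binary.Permutation.Propositional.Properties using (↭-length)
open import Data.List.Relation.Unary.All as All using (All; []; _∷_)
import Data.List.Relation.Unary.All.Properties as Allₚ
open import Data.List.Relation.Unary.AllPairs using ([]; _∷_)
open import Data.List.Relation.Unary.Any using (here)
open import Data.List.Relation.Unary.Unique.Propositional using (Unique)
import Data.List.Relation.Unary.Unique.Propositional.Properties as Uniqueₚ
open import Data.Nat using (ℕ; zero; suc; _+_; _*_; _∸_; _≡ᵇ_; _≤ᵇ_; _≤_; _<_; z≤n; s≤s; s≤s⁻¹; _≤?_; _<?_)
open import Data.Nat.DivMod using (_/_; _%_; m<n⇒m%n≡m; m<n⇒m/n≡0; m/n≡1+[m∸n]/n; [m+n]%n≡m%n)
open import Data.Nat.Induction using (<-rec)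
open import Data.Nat.ListAction.Properties using (sum-++)
open import Data.Nat.Properties
open import Data.Product using (_×_; _,_; proj₁; proj₂)
open import Data.Sum using (inj₁; inj₂)
open import Function using (_∘′_; id)
open import Function.Bundles using (Equivalence; _⇔_; mk⇔)
open import Relation.Binary.PropositionalEquality hiding ([_])
open import Relation.Nullary using (¬_; Dec; yes; no; contradiction)
open import Relation.Nullary.Decidable using (_×-dec_)

open +-*-Solver using (solve; _:+_; _:-_; _:=_)

sumZ-++ : ∀ xs ys → sumZ (xs ++ ys) ≡ sumZ xs +ᶻ sumZ ys
sumZ-++ []       ys = sym (ℤₚ.+-identityˡ _)
sumZ-++ (x ∷ xs) ys = trans (cong (x +ᶻ_) (sumZ-++ xs ys)) (sym (ℤₚ.+-assoc x _ _))

sumZ-concatMap : ∀ {A : Set} (h : A → List ℤ) xs →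
                 sumZ (concatMap h xs) ≡ sumZ (map (λ a → sumZ (h a)) xs)
sumZ-concatMap h []       = refl
sumZ-concatMap h (x ∷ xs) = trans (sumZ-++ (h x) _) (cong (sumZ (h x) +ᶻ_) (sumZ-concatMap h xs))

∑≤ : ℕ → (ℕ → ℤ) → ℤ
∑≤ zero    F = F 0
∑≤ (suc k) F = ∑≤ k F +ᶻ F (suc k)

sumZ-map-upTo : ∀ k F → sumZ (map F (upTo (suc k))) ≡ ∑≤ k F
sumZ-map-upTo zero    F = ℤₚ.+-identityʳ (F 0)
sumZ-map-upTo (suc k) F = begin
  sumZ (map F (upTo (suc (suc k))))        ≡⟨ cong (sumZ ∘′ map F) (sym (upTo-∷ʳ (suc k))) ⟩
  sumZ (map F (upTo (suc k) ++ [ suc k ])) ≡⟨ cong sumZ (map-++ F (upTo (suc k)) [ suc k ]) ⟩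
  sumZ (map F (upTo (suc k)) ++ [ F (suc k) ]) ≡⟨ sumZ-++ (map F (upTo (suc k))) _ ⟩
  sumZ (map F (upTo (suc k))) +ᶻ (F (suc k) +ᶻ + 0)
    ≡⟨ cong₂ _+ᶻ_ (sumZ-map-upTo k F) (ℤₚ.+-identityʳ (F (suc k))) ⟩
  ∑≤ (suc k) F ∎
  where open ≡-Reasoning

module _ {F G : ℕ → ℤ} where

  ∑≤-cong : ∀ k → (∀ a → a ≤ k → F a ≡ G a) → ∑≤ k F ≡ ∑≤ k G
  ∑≤-cong zero    e = e 0 z≤n
  ∑≤-cong (suc k) e = cong₂ _+ᶻ_ (∑≤-cong k (λ a a≤k → e a (m≤n⇒m≤1+n a≤k))) (e (suc k) ≤-refl)

  ∑≤-+ : ∀ k → ∑≤ k (λ a → F a +ᶻ G a) ≡ ∑≤ k F +ᶻ ∑≤ k G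
  ∑≤-+ zero    = refl
  ∑≤-+ (suc k) = trans (cong (_+ᶻ (F (suc k) +ᶻ G (suc k))) (∑≤-+ k))
                       (interchange (∑≤ k F) (∑≤ k G) (F (suc k)) (G (suc k)))
    where
    interchange : ∀ x y z w → (x +ᶻ y) +ᶻ (z +ᶻ w) ≡ (x +ᶻ z) +ᶻ (y +ᶻ w)
    interchange = solve 4 (λ x y z w → (x :+ y) :+ (z :+ w) := (x :+ z) :+ (y :+ w)) refl

module _ {F : ℕ → ℤ} where

  ∑≤-zero : ∀ k → (∀ a → a ≤ k → F a ≡ + 0) → ∑≤ k F ≡ + 0
  ∑≤-zero zero    e = e 0 z≤n
  ∑≤-zero (suc k) e = cong₂ _+ᶻ_ (∑≤-zero k (λ a a≤k → e a (m≤n⇒m≤1+n a≤k))) (e (suc k) ≤-refl)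

  ∑≤-restrict : ∀ {k' k} → k' ≤ k → (∀ a → k' < a → a ≤ k → F a ≡ + 0) → ∑≤ k F ≡ ∑≤ k' F
  ∑≤-restrict {k'} {k} k'≤k e with m≤n⇒m<n∨m≡n k'≤k
  ... | inj₂ refl = refl
  ... | inj₁ k'<k with k
  ...   | suc k₀ = begin
    ∑≤ k₀ F +ᶻ F (suc k₀) ≡⟨ cong₂ _+ᶻ_ (∑≤-restrict (s≤s⁻¹ k'<k) (λ a k'<a a≤k₀ → e a k'<a (m≤n⇒m≤1+n a≤k₀)))
                                         (e (suc k₀) k'<k ≤-refl) ⟩
    ∑≤ k' F +ᶻ + 0        ≡⟨ ℤₚ.+-identityʳ _ ⟩
    ∑≤ k' F               ∎
    where open ≡-Reasoning

  ∑≤-delta : ∀ {p} k → p ≤ k → (∀ a → a ≤ k → a ≢ p → F a ≡ + 0) → ∑≤ k F ≡ F p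
  ∑≤-delta zero p≤0 e rewrite n≤0⇒n≡0 p≤0 = refl
  ∑≤-delta {p} (suc k) p≤k e with m≤n⇒m<n∨m≡n p≤k
  ... | inj₂ refl = trans (cong (_+ᶻ F (suc k)) (∑≤-zero k (λ a a≤k → e a (m≤n⇒m≤1+n a≤k) (<⇒≢ (s≤s a≤k)))))
                          (ℤₚ.+-identityˡ _)
  ... | inj₁ p<k  = trans (cong₂ _+ᶻ_ (∑≤-delta k (s≤s⁻¹ p<k) (λ a a≤k → e a (m≤n⇒m≤1+n a≤k)))
                                      (e (suc k) ≤-refl (≢-sym (<⇒≢ p<k))))
                          (ℤₚ.+-identityʳ _)

_≤³_ : ℕ × ℕ × ℕ → ℕ × ℕ × ℕ → Set
(a , b , c) ≤³ (i , j , n) = a ≤ i × b ≤ j × c ≤ n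

_≤³?_ : ∀ u v → Dec (u ≤³ v)
(a , b , c) ≤³? (i , j , n) = a ≤? i ×-dec b ≤? j ×-dec c ≤? n

∑³ : ℕ → ℕ → ℕ → (ℕ → ℕ → ℕ → ℤ) → ℤ
∑³ i j k F = ∑≤ i λ x → ∑≤ j λ y → ∑≤ k λ z → F x y z

module _ (i j k : ℕ) where

  ∑³-cong : ∀ {F G} → (∀ x y z → (x , y , z) ≤³ (i , j , k) → F x y z ≡ G x y z) →
            ∑³ i j k F ≡ ∑³ i j k G
  ∑³-cong e = ∑≤-cong i λ x x≤i → ∑≤-cong j λ y y≤j → ∑≤-cong k λ z z≤k → e x y z (x≤i , y≤j , z≤k)

  ∑³-zero : ∀ {F} → (∀ x y z → (x , y , z) ≤³ (i , j , k) → F x y z ≡ + 0) → ∑³ i j k F ≡ + 0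
  ∑³-zero e = ∑≤-zero i λ x x≤i → ∑≤-zero j λ y y≤j → ∑≤-zero k λ z z≤k → e x y z (x≤i , y≤j , z≤k)

  ∑³-+ : ∀ F G → ∑³ i j k (λ x y z → F x y z +ᶻ G x y z) ≡ ∑³ i j k F +ᶻ ∑³ i j k G
  ∑³-+ F G = trans (∑≤-cong i λ x _ → trans (∑≤-cong j λ y _ → ∑≤-+ k) (∑≤-+ j)) (∑≤-+ i)

module _ {i j k : ℕ} where

  ∑³-restrict : ∀ {F i' j' k'} → (i' , j' , k') ≤³ (i , j , k) →
                (∀ x y z → (x , y , z) ≤³ (i , j , k) → ¬ (x , y , z) ≤³ (i' , j' , k') → F x y z ≡ + 0) →
                ∑³ i j k F ≡ ∑³ i' j' k' F
  ∑³-restrict {i' = i'} {j'} (i'≤i , j'≤j , k'≤k) e =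
    trans (∑≤-restrict i'≤i λ x i'<x x≤i → ∑≤-zero j λ y y≤j → ∑≤-zero k λ z z≤k →
             e x y z (x≤i , y≤j , z≤k) λ (x≤i' , _) → <⇒≱ i'<x x≤i')
    (∑≤-cong i' λ x x≤i' →
      trans (∑≤-restrict j'≤j λ y j'<y y≤j → ∑≤-zero k λ z z≤k →
               e x y z (≤-trans x≤i' i'≤i , y≤j , z≤k) λ (_ , y≤j' , _) → <⇒≱ j'<y y≤j')
      (∑≤-cong j' λ y y≤j' →
        ∑≤-restrict k'≤k λ z k'<z z≤k →
          e x y z (≤-trans x≤i' i'≤i , ≤-trans y≤j' j'≤j , z≤k) λ (_ , _ , z≤k') → <⇒≱ k'<z z≤k'))

  ∑³-delta : ∀ {F p q r} → (p , q , r) ≤³ (i , j , k) →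
             (∀ x y z → (x , y , z) ≤³ (i , j , k) → (x , y , z) ≢ (p , q , r) → F x y z ≡ + 0) →
             ∑³ i j k F ≡ F p q r
  ∑³-delta (p≤i , q≤j , r≤k) e =
    trans (∑≤-delta i p≤i λ x x≤i x≢p → ∑≤-zero j λ y y≤j → ∑≤-zero k λ z z≤k →
             e x y z (x≤i , y≤j , z≤k) λ eq → x≢p (cong proj₁ eq))
    (trans (∑≤-delta j q≤j λ y y≤j y≢q → ∑≤-zero k λ z z≤k →
              e _ y z (p≤i , y≤j , z≤k) λ eq → y≢q (cong (proj₁ ∘′ proj₂) eq))
      (∑≤-delta k r≤k λ z z≤k z≢r → e _ _ z (p≤i , q≤j , z≤k) λ eq → z≢r (cong (proj₂ ∘′ proj₂) eq)))

⊛-as-∑³ : ∀ f g i j n → (f ⊛ g) i j n ≡ ∑³ i j n (λ x y z → f x y z *ᶻ g (i ∸ x) (j ∸ y) (n ∸ z))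
⊛-as-∑³ f g i j n =
  trans (sumZ-concatMap-upTo i λ x → concatMap (λ y → map (term x y) (upTo (suc n))) (upTo (suc j)))
    (∑≤-cong i λ x _ → trans (sumZ-concatMap-upTo j λ y → map (term x y) (upTo (suc n)))
      (∑≤-cong j λ y _ → sumZ-map-upTo n (term x y)))
  where
  term : ℕ → ℕ → ℕ → ℤ
  term x y z = f x y z *ᶻ g (i ∸ x) (j ∸ y) (n ∸ z)

  sumZ-concatMap-upTo : ∀ k (h : ℕ → List ℤ) → sumZ (concatMap h (upTo (suc k))) ≡ ∑≤ k (λ a → sumZ (h a))
  sumZ-concatMap-upTo k h = trans (sumZ-concatMap h (upTo (suc k))) (sumZ-map-upTo k _)

cong-series : ∀ (f : Series) {i i' j j' n n'} → i ≡ i' → j ≡ j' → n ≡ n' → f i j n ≡ f i' j' n'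
cong-series f refl refl refl = refl

*-vanishʳ : ∀ x {y} → y ≡ + 0 → x *ᶻ y ≡ + 0
*-vanishʳ x refl = ℤₚ.*-zeroʳ x

∸-comm : ∀ m n o → m ∸ n ∸ o ≡ m ∸ o ∸ n
∸-comm m n o = trans (∸-+-assoc m n o) (trans (cong (m ∸_) (+-comm n o)) (sym (∸-+-assoc m o n)))

≤-∸-swap : ∀ {a x i} → a ≤ i → x ≤ i ∸ a → a ≤ i ∸ x
≤-∸-swap {a} {x} {i} a≤i x≤i∸a = m+n≤o⇒m≤o∸n a (subst (_≤ i) (+-comm x a) (m≤o∸n⇒m+n≤o x a≤i x≤i∸a))

≤³-∸-swap : ∀ {a b c x y z i j n} → (a , b , c) ≤³ (i , j , n) →
            (x , y , z) ≤³ (i ∸ a , j ∸ b , n ∸ c) → (a , b , c) ≤³ (i ∸ x , j ∸ y , n ∸ z)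
≤³-∸-swap (a≤i , b≤j , c≤n) (x≤ , y≤ , z≤) = ≤-∸-swap a≤i x≤ , ≤-∸-swap b≤j y≤ , ≤-∸-swap c≤n z≤

≤³-∸ : ∀ {a b c x y z i j n} → (a , b , c) ≤³ (i ∸ x , j ∸ y , n ∸ z) → (a , b , c) ≤³ (i , j , n)
≤³-∸ {x = x} {y} {z} {i} {j} {n} (a≤ , b≤ , c≤) =
  ≤-trans a≤ (m∸n≤m i x) , ≤-trans b≤ (m∸n≤m j y) , ≤-trans c≤ (m∸n≤m n z)

module _ {A : Set} {x y : A} where

  if-true : ∀ {p} → T p → (if p then x else y) ≡ x
  if-true {true} _ = refl

  if-false : ∀ {p} → ¬ T p → (if p then x else y) ≡ y
  if-false {true}  ¬t = contradiction _ ¬t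
  if-false {false} _  = refl

T-∧³ : ∀ {p q r} → T (p ∧ q ∧ r) → T p × T q × T r
T-∧³ t with tp , tqr ← Equivalence.to T-∧ t = tp , Equivalence.to T-∧ tqr

T-mono-cond : ∀ {a b c x y z} → T ((x ≡ᵇ a) ∧ (y ≡ᵇ b) ∧ (z ≡ᵇ c)) → (x , y , z) ≡ (a , b , c)
T-mono-cond {a} {b} {c} {x} {y} {z} t with x≡ᵇa , y≡ᵇb , z≡ᵇc ← T-∧³ t =
  cong₂ _,_ (≡ᵇ⇒≡ x a x≡ᵇa) (cong₂ _,_ (≡ᵇ⇒≡ y b y≡ᵇb) (≡ᵇ⇒≡ z c z≡ᵇc))

mono-on : ∀ {a b c x y z} → (x , y , z) ≡ (a , b , c) → mono a b c x y z ≡ + 1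
mono-on {a} {b} {c} refl = if-true (Equivalence.from T-∧ (≡⇒≡ᵇ a a refl ,
                                    Equivalence.from T-∧ (≡⇒≡ᵇ b b refl , ≡⇒≡ᵇ c c refl)))

mono-off : ∀ {a b c x y z} → (x , y , z) ≢ (a , b , c) → mono a b c x y z ≡ + 0
mono-off ne = if-false (ne ∘′ T-mono-cond)

shift : ℕ → ℕ → ℕ → Series → Series
shift a b c f i j n with (a , b , c) ≤³? (i , j , n)
... | yes _ = f (i ∸ a) (j ∸ b) (n ∸ c)
... | no  _ = + 0

module _ (a b c : ℕ) (f : Series) {i j n : ℕ} where

  shift-inside : (a , b , c) ≤³ (i , j , n) → shift a b c f i j n ≡ f (i ∸ a) (j ∸ b) (n ∸ c)
  shift-inside s with (a , b , c) ≤³? (i , j , n)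
  ... | yes _  = refl
  ... | no  ¬s = contradiction s ¬s

  shift-outside : ¬ (a , b , c) ≤³ (i , j , n) → shift a b c f i j n ≡ + 0
  shift-outside ¬s with (a , b , c) ≤³? (i , j , n)
  ... | yes s = contradiction s ¬s
  ... | no  _ = refl

module _ (a b c : ℕ) where

  shift-cong : ∀ {f g} → f ≋ g → shift a b c f ≋ shift a b c g
  shift-cong e i j n with (a , b , c) ≤³? (i , j , n)
  ... | yes _ = e _ _ _
  ... | no  _ = refl

  shift-⊕ : ∀ f g → shift a b c (f ⊕ g) ≋ shift a b c f ⊕ shift a b c g
  shift-⊕ f g i j n with (a , b , c) ≤³? (i , j , n)
  ... | yes _ = refl
  ... | no  _ = refl

  shift-⊖ : ∀ f g → shift a b c (f ⊖ g) ≋ shift a b c f ⊖ shift a b c g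
  shift-⊖ f g i j n with (a , b , c) ≤³? (i , j , n)
  ... | yes _ = refl
  ... | no  _ = refl

⊛-congʳ : ∀ f {g g'} → g ≋ g' → f ⊛ g ≋ f ⊛ g'
⊛-congʳ f {g} {g'} e i j n =
  trans (⊛-as-∑³ f g i j n)
    (trans (∑³-cong i j n λ x y z _ → cong (f x y z *ᶻ_) (e (i ∸ x) (j ∸ y) (n ∸ z))) (sym (⊛-as-∑³ f g' i j n)))

⊛-distribˡ-⊕ : ∀ f g h → f ⊛ (g ⊕ h) ≋ f ⊛ g ⊕ f ⊛ h
⊛-distribˡ-⊕ f g h i j n = begin
  (f ⊛ (g ⊕ h)) i j n
    ≡⟨ ⊛-as-∑³ f (g ⊕ h) i j n ⟩
  ∑³ i j n (λ x y z → f x y z *ᶻ (g ⊕ h) (i ∸ x) (j ∸ y) (n ∸ z))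
    ≡⟨ ∑³-cong i j n (λ x y z _ → ℤₚ.*-distribˡ-+ (f x y z) _ _) ⟩
  ∑³ i j n (λ x y z → f x y z *ᶻ g (i ∸ x) (j ∸ y) (n ∸ z) +ᶻ f x y z *ᶻ h (i ∸ x) (j ∸ y) (n ∸ z))
    ≡⟨ ∑³-+ i j n _ _ ⟩
  _ ≡⟨ sym (cong₂ _+ᶻ_ (⊛-as-∑³ f g i j n) (⊛-as-∑³ f h i j n)) ⟩
  (f ⊛ g ⊕ f ⊛ h) i j n ∎
  where open ≡-Reasoning

⊛-identityʳ : ∀ f → f ⊛ one ≋ f
⊛-identityʳ f i j n = begin
  (f ⊛ one) i j n
    ≡⟨ ⊛-as-∑³ f one i j n ⟩
  ∑³ i j n (λ x y z → f x y z *ᶻ one (i ∸ x) (j ∸ y) (n ∸ z))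
    ≡⟨ ∑³-delta (≤-refl , ≤-refl , ≤-refl)
                (λ x y z xyz≤ ne → *-vanishʳ (f x y z) (mono-off (ne ∘′ diagonal xyz≤))) ⟩
  f i j n *ᶻ one (i ∸ i) (j ∸ j) (n ∸ n)
    ≡⟨ cong (f i j n *ᶻ_) (mono-on (cong₂ _,_ (n∸n≡0 i) (cong₂ _,_ (n∸n≡0 j) (n∸n≡0 n)))) ⟩
  f i j n *ᶻ + 1
    ≡⟨ ℤₚ.*-identityʳ _ ⟩
  f i j n ∎
  where
  open ≡-Reasoning
  ∸≡0⇒≡ : ∀ {x k} → x ≤ k → k ∸ x ≡ 0 → x ≡ k
  ∸≡0⇒≡ x≤k e = ≤-antisym x≤k (m∸n≡0⇒m≤n e)
  diagonal : ∀ {x y z} → (x , y , z) ≤³ (i , j , n) → (i ∸ x , j ∸ y , n ∸ z) ≡ (0 , 0 , 0) →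
             (x , y , z) ≡ (i , j , n)
  diagonal (x≤ , y≤ , z≤) e = cong₂ _,_ (∸≡0⇒≡ x≤ (cong proj₁ e))
    (cong₂ _,_ (∸≡0⇒≡ y≤ (cong (proj₁ ∘′ proj₂) e)) (∸≡0⇒≡ z≤ (cong (proj₂ ∘′ proj₂) e)))

mono-⊛ : ∀ a b c h → mono a b c ⊛ h ≋ shift a b c h
mono-⊛ a b c h i j n with (a , b , c) ≤³? (i , j , n)
... | yes abc≤ = begin
  (mono a b c ⊛ h) i j n
    ≡⟨ ⊛-as-∑³ (mono a b c) h i j n ⟩
  ∑³ i j n (λ x y z → mono a b c x y z *ᶻ h (i ∸ x) (j ∸ y) (n ∸ z))
    ≡⟨ ∑³-delta abc≤ (λ x y z _ ne → cong (_*ᶻ h (i ∸ x) (j ∸ y) (n ∸ z)) (mono-off ne)) ⟩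
  mono a b c a b c *ᶻ h (i ∸ a) (j ∸ b) (n ∸ c)
    ≡⟨ cong (_*ᶻ h (i ∸ a) (j ∸ b) (n ∸ c)) (mono-on {a} {b} {c} refl) ⟩
  + 1 *ᶻ h (i ∸ a) (j ∸ b) (n ∸ c)
    ≡⟨ ℤₚ.*-identityˡ _ ⟩
  h (i ∸ a) (j ∸ b) (n ∸ c) ∎
  where open ≡-Reasoning
... | no out = trans (⊛-as-∑³ (mono a b c) h i j n) (∑³-zero i j n λ x y z xyz≤ →
      cong (_*ᶻ h (i ∸ x) (j ∸ y) (n ∸ z)) (mono-off {a} {b} {c} {x} {y} {z} λ { refl → out xyz≤ }))

⊛-shift : ∀ a b c f h → f ⊛ shift a b c h ≋ shift a b c (f ⊛ h)
⊛-shift a b c f h i j n = by-cases ((a , b , c) ≤³? (i , j , n))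
  where
  open ≡-Reasoning
  by-cases : Dec ((a , b , c) ≤³ (i , j , n)) → (f ⊛ shift a b c h) i j n ≡ shift a b c (f ⊛ h) i j n
  by-cases (yes abc≤) = begin
    (f ⊛ shift a b c h) i j n
      ≡⟨ ⊛-as-∑³ f (shift a b c h) i j n ⟩
    ∑³ i j n (λ x y z → f x y z *ᶻ shift a b c h (i ∸ x) (j ∸ y) (n ∸ z))
      ≡⟨ ∑³-restrict (m∸n≤m i a , m∸n≤m j b , m∸n≤m n c) (λ x y z xyz≤ outside →
           *-vanishʳ (f x y z) (shift-outside a b c h λ abc≤' → outside (≤³-∸-swap xyz≤ abc≤'))) ⟩
    ∑³ (i ∸ a) (j ∸ b) (n ∸ c) (λ x y z → f x y z *ᶻ shift a b c h (i ∸ x) (j ∸ y) (n ∸ z))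
      ≡⟨ ∑³-cong (i ∸ a) (j ∸ b) (n ∸ c) (λ x y z xyz≤ → cong (f x y z *ᶻ_)
           (trans (shift-inside a b c h (≤³-∸-swap abc≤ xyz≤))
                  (cong-series h (∸-comm i x a) (∸-comm j y b) (∸-comm n z c)))) ⟩
    ∑³ (i ∸ a) (j ∸ b) (n ∸ c) (λ x y z → f x y z *ᶻ h (i ∸ a ∸ x) (j ∸ b ∸ y) (n ∸ c ∸ z))
      ≡⟨ sym (⊛-as-∑³ f h _ _ _) ⟩
    (f ⊛ h) (i ∸ a) (j ∸ b) (n ∸ c)
      ≡⟨ sym (shift-inside a b c (f ⊛ h) abc≤) ⟩
    shift a b c (f ⊛ h) i j n ∎
  by-cases (no out) = begin
    (f ⊛ shift a b c h) i j n
      ≡⟨ ⊛-as-∑³ f (shift a b c h) i j n ⟩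
    ∑³ i j n (λ x y z → f x y z *ᶻ shift a b c h (i ∸ x) (j ∸ y) (n ∸ z))
      ≡⟨ ∑³-zero i j n (λ x y z _ →
           *-vanishʳ (f x y z) (shift-outside a b c h λ s → out (≤³-∸ {x = x} {y} {z} s))) ⟩
    + 0
      ≡⟨ sym (shift-outside a b c (f ⊛ h) out) ⟩
    shift a b c (f ⊛ h) i j n ∎

≡ᵇ-+ˡ : ∀ {a u} x → a ≤ u → (u ≡ᵇ a + x) ≡ (u ∸ a ≡ᵇ x)
≡ᵇ-+ˡ x z≤n       = refl
≡ᵇ-+ˡ x (s≤s a≤u) = ≡ᵇ-+ˡ x a≤u

module _ (a b c : ℕ) where

  geom-below : ∀ {u v w} → w < suc c → geom a b (suc c) u v w ≡ one u v w
  geom-below {u} {v} {w} w≤c rewrite m<n⇒m%n≡m w≤c | m<n⇒m/n≡0 w≤c =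
    cong (if_then + 1 else + 0) (trans (∧-comm (w ≡ᵇ 0) _) (∧-assoc (u ≡ᵇ 0) (v ≡ᵇ 0) (w ≡ᵇ 0)))

  geom-above : ∀ {u v w} → suc c ≤ w → geom a b (suc c) u v w ≡ shift a b (suc c) (geom a b (suc c)) u v w
  geom-above {u} {v} {w} c<w
    rewrite m/n≡1+[m∸n]/n c<w
          | trans (cong (_% suc c) (sym (m∸n+n≡m c<w))) ([m+n]%n≡m%n (w ∸ suc c) (suc c))
    = by-cases ((a , b , suc c) ≤³? (u , v , w))
    where
    k = (w ∸ suc c) / suc c
    divides = (w ∸ suc c) % suc c ≡ᵇ 0
    u≡ka = u ≡ᵇ a + k * a
    v≡kb = v ≡ᵇ b + k * b
    cond = divides ∧ u≡ka ∧ v≡kb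
    by-cases : Dec ((a , b , suc c) ≤³ (u , v , w)) →
               (if cond then + 1 else + 0) ≡ shift a b (suc c) (geom a b (suc c)) u v w
    by-cases (yes s@(a≤u , b≤v , _))
      rewrite shift-inside a b (suc c) (geom a b (suc c)) s | ≡ᵇ-+ˡ (k * a) a≤u | ≡ᵇ-+ˡ (k * b) b≤v = refl
    by-cases (no out) =
      trans (if-false λ t → out (support t)) (sym (shift-outside a b (suc c) (geom a b (suc c)) out))
      where
      support : T cond → (a , b , suc c) ≤³ (u , v , w)
      support t with _ , u≡ , v≡ ← T-∧³ {divides} {u≡ka} {v≡kb} t =
        subst (a ≤_) (sym (≡ᵇ⇒≡ u (a + k * a) u≡)) (m≤m+n a (k * a)) ,
        subst (b ≤_) (sym (≡ᵇ⇒≡ v (b + k * b) v≡)) (m≤m+n b (k * b)) , c<w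

  geom-unfold : geom a b (suc c) ≋ one ⊕ shift a b (suc c) (geom a b (suc c))
  geom-unfold u v w with w <? suc c
  ... | yes w≤c = sym (begin
    one u v w +ᶻ shift a b (suc c) (geom a b (suc c)) u v w
      ≡⟨ cong (one u v w +ᶻ_) (shift-outside a b (suc c) _ λ (_ , _ , c<w) → <⇒≱ w≤c c<w) ⟩
    one u v w +ᶻ + 0 ≡⟨ ℤₚ.+-identityʳ _ ⟩
    one u v w ≡⟨ sym (geom-below {u} {v} w≤c) ⟩
    geom a b (suc c) u v w ∎)
    where open ≡-Reasoning
  ... | no w≰c = sym (begin
    one u v w +ᶻ shift a b (suc c) (geom a b (suc c)) u v w
      ≡⟨ cong (_+ᶻ shift a b (suc c) (geom a b (suc c)) u v w)
              (mono-off {0} {0} {0} {u} {v} {w} λ eq →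
                 <⇒≢ (≤-trans (s≤s z≤n) c<w) (sym (cong (proj₂ ∘′ proj₂) eq))) ⟩
    + 0 +ᶻ shift a b (suc c) (geom a b (suc c)) u v w ≡⟨ ℤₚ.+-identityˡ _ ⟩
    shift a b (suc c) (geom a b (suc c)) u v w ≡⟨ sym (geom-above c<w) ⟩
    geom a b (suc c) u v w ∎)
    where
    open ≡-Reasoning
    c<w = ≮⇒≥ w≰c

  ⊛-geom-unfold : ∀ f → f ⊛ geom a b (suc c) ≋ f ⊕ shift a b (suc c) (f ⊛ geom a b (suc c))
  ⊛-geom-unfold f i j n = begin
    (f ⊛ G) i j n                              ≡⟨ ⊛-congʳ f geom-unfold i j n ⟩
    (f ⊛ (one ⊕ shift a b (suc c) G)) i j n    ≡⟨ ⊛-distribˡ-⊕ f one (shift a b (suc c) G) i j n ⟩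
    (f ⊛ one) i j n +ᶻ (f ⊛ shift a b (suc c) G) i j n
      ≡⟨ cong₂ _+ᶻ_ (⊛-identityʳ f i j n) (⊛-shift a b (suc c) f G i j n) ⟩
    (f ⊕ shift a b (suc c) (f ⊛ G)) i j n      ∎
    where
    open ≡-Reasoning
    G = geom a b (suc c)

  shift-fixpoint-unique : ∀ {Q h h'} → h ≋ Q ⊕ shift a b (suc c) h → h' ≋ Q ⊕ shift a b (suc c) h' → h ≋ h'
  shift-fixpoint-unique {Q} {h} {h'} e e' i j n = <-rec (λ n → ∀ i j → h i j n ≡ h' i j n) step n i j
    where
    step : ∀ n → (∀ {m} → m < n → ∀ i j → h i j m ≡ h' i j m) → ∀ i j → h i j n ≡ h' i j n
    step n ih i j = trans (e i j n) (trans (cong (Q i j n +ᶻ_) shifts-agree) (sym (e' i j n)))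
      where
      shifts-agree : shift a b (suc c) h i j n ≡ shift a b (suc c) h' i j n
      shifts-agree with (a , b , suc c) ≤³? (i , j , n)
      ... | yes (_ , _ , c<n) = ih (∸-monoʳ-< (s≤s z≤n) c<n) (i ∸ a) (j ∸ b)
      ... | no  _             = refl

  shift-recurrence-solution : ∀ {P P' P''} → P ≋ P' ⊕ shift a b (suc c) (P ⊖ P'') →
                              P ≋ P' ⊛ geom a b (suc c) ⊖ P'' ⊛ (mono a b (suc c) ⊛ geom a b (suc c))
  shift-recurrence-solution {P} {P'} {P''} rec = shift-fixpoint-unique {Q = Q} P-fixpoint R-fixpoint
    where
    G = geom a b (suc c)
    R = P' ⊛ G ⊖ P'' ⊛ (mono a b (suc c) ⊛ G)
    Q = P' ⊖ shift a b (suc c) P''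

    P-fixpoint : P ≋ Q ⊕ shift a b (suc c) P
    P-fixpoint i j n = trans (rec i j n) (trans (cong (P' i j n +ᶻ_) (shift-⊖ a b (suc c) P P'' i j n))
      (regroup (P' i j n) (shift a b (suc c) P i j n) (shift a b (suc c) P'' i j n)))
      where
      regroup : ∀ p s t → p +ᶻ (s -ᶻ t) ≡ (p -ᶻ t) +ᶻ s
      regroup = solve 3 (λ p s t → p :+ (s :- t) := (p :- t) :+ s) refl

    twist : P'' ⊛ (mono a b (suc c) ⊛ G) ≋ shift a b (suc c) (P'' ⊛ G)
    twist i j n = trans (⊛-congʳ P'' (mono-⊛ a b (suc c) G) i j n) (⊛-shift a b (suc c) P'' G i j n)

    R-fixpoint : R ≋ Q ⊕ shift a b (suc c) R
    R-fixpoint i j n = begin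
      R i j n
        ≡⟨ cong₂ _-ᶻ_ (⊛-geom-unfold P' i j n)
                       (trans (twist i j n) (shift-cong a b (suc c) (⊛-geom-unfold P'') i j n)) ⟩
      (P' i j n +ᶻ S' i j n) -ᶻ shift a b (suc c) (P'' ⊕ S'') i j n
        ≡⟨ cong ((P' i j n +ᶻ S' i j n) -ᶻ_) (shift-⊕ a b (suc c) P'' S'' i j n) ⟩
      (P' i j n +ᶻ S' i j n) -ᶻ (shift a b (suc c) P'' i j n +ᶻ shift a b (suc c) S'' i j n)
        ≡⟨ regroup (P' i j n) (S' i j n) (shift a b (suc c) P'' i j n) (shift a b (suc c) S'' i j n) ⟩
      Q i j n +ᶻ (S' i j n -ᶻ shift a b (suc c) S'' i j n)
        ≡⟨ cong (Q i j n +ᶻ_) (sym (trans (shift-⊖ a b (suc c) _ _ i j n)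
                                          (cong (S' i j n -ᶻ_) (shift-cong a b (suc c) twist i j n)))) ⟩
      (Q ⊕ shift a b (suc c) R) i j n ∎
      where
      open ≡-Reasoning
      S' = shift a b (suc c) (P' ⊛ G)
      S'' = shift a b (suc c) (P'' ⊛ G)
      regroup : ∀ p s t u → (p +ᶻ s) -ᶻ (t +ᶻ u) ≡ (p -ᶻ t) +ᶻ (s -ᶻ u)
      regroup = solve 4 (λ p s t u → (p :+ s) :- (t :+ u) := (p :- t) :+ (s :- u)) refl

count-++ : ∀ {A : Set} (p : A → Bool) xs ys → count p (xs ++ ys) ≡ count p xs + count p ys
count-++ p xs ys = trans (cong length (filter-++ (λ x → T? (p x)) xs ys)) (length-++ (filterᵇ p xs))

count-none : ∀ {A : Set} (p : A → Bool) {xs} → (∀ {x} → x ∈ xs → ¬ T (p x)) → count p xs ≡ 0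
count-none p none = cong length (filter-none (λ x → T? (p x)) (All.tabulate none))

module _ {A B : Set} (p : A → Bool) (q : B → Bool) (f : A → B) (g : B → A) where

  count-bijection : ∀ {xs ys} → Unique xs → Unique ys →
    (∀ {x} → x ∈ xs → T (p x) → f x ∈ ys × T (q (f x)) × g (f x) ≡ x) →
    (∀ {y} → y ∈ ys → T (q y) → g y ∈ xs × T (p (g y)) × f (g y) ≡ y) →
    count p xs ≡ count q ys
  count-bijection {xs} {ys} xs! ys! forth back =
    trans (sym (length-map f X)) (↭-length (∼bag⇒↭ (unique∧set⇒bag fX! Y! (mk⇔ fX⊆Y Y⊆fX))))
    where
    X = filterᵇ p xs
    Y = filterᵇ q ys
    X! : Unique X
    X! = Uniqueₚ.filter⁺ (λ x → T? (p x)) xs!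
    Y! : Unique Y
    Y! = Uniqueₚ.filter⁺ (λ y → T? (q y)) ys!
    gf-id : All (λ x → g (f x) ≡ x) X
    gf-id = All.tabulate λ x∈X →
      let x∈ , px = ∈-filter⁻ (λ x → T? (p x)) x∈X in proj₂ (proj₂ (forth x∈ px))
    -- f is injective on X because g undoes it there
    fX! : Unique (map f X)
    fX! = Uniqueₚ.map⁻ {f = g} (subst Unique (trans (sym (map-id-local gf-id)) (map-∘ X)) X!)
    fX⊆Y : ∀ {y} → y ∈ map f X → y ∈ Y
    fX⊆Y y∈ with x , x∈X , refl ← ∈-map⁻ f y∈ =
      let x∈ , px = ∈-filter⁻ (λ x → T? (p x)) x∈X ; fx∈ , qfx , _ = forth x∈ px
      in ∈-filter⁺ (λ y → T? (q y)) fx∈ qfx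
    Y⊆fX : ∀ {y} → y ∈ Y → y ∈ map f X
    Y⊆fX y∈Y =
      let y∈ , qy = ∈-filter⁻ (λ y → T? (q y)) y∈Y ; gy∈ , pgy , fgy≡y = back y∈ qy
      in subst (_∈ map f X) fgy≡y (∈-map⁺ f (∈-filter⁺ (λ x → T? (p x)) gy∈ pgy))

concatMap-prepend : ∀ (vs : List ℕ) (L : List (List ℕ)) →
                    concatMap (λ v → map (v ∷_) L) vs ≡ cartesianProductWith List._∷_ vs L
concatMap-prepend []       L = refl
concatMap-prepend (v ∷ vs) L = cong (map (v ∷_) L ++_) (concatMap-prepend vs L)

lists-unique : ∀ N n → Unique (lists N n)
lists-unique zero    n = [] ∷ []
lists-unique (suc N) n = subst Unique (sym (concatMap-prepend (map suc (upTo n)) (lists N n)))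
  (Uniqueₚ.cartesianProductWith⁺ List._∷_ ∷-injective (Uniqueₚ.map⁺ suc-injective (Uniqueₚ.upTo⁺ n))
                                 (lists-unique N n))

∈-lists⁺ : ∀ {n l} → All (λ v → 0 < v × v ≤ n) l → l ∈ lists (length l) n
∈-lists⁺ []                                     = here refl
∈-lists⁺ {n} {suc v ∷ l} ((_ , v<n) ∷ in-range) =
  subst (suc v ∷ l ∈_) (sym (concatMap-prepend (map suc (upTo n)) (lists (length l) n)))
        (∈-cartesianProductWith⁺ List._∷_ (∈-map⁺ suc (∈-upTo⁺ v<n)) (∈-lists⁺ in-range))

∈-lists⁻ : ∀ {N n l} → l ∈ lists N n → length l ≡ N × All (0 <_) l
∈-lists⁻ {zero}  (here refl) = refl , []
∈-lists⁻ {suc N} {n} {l} l∈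
  with v , l' , v∈ , l'∈ , refl ← ∈-cartesianProductWith⁻ List._∷_ (map suc (upTo n)) (lists N n)
                                   (subst (l ∈_) (concatMap-prepend (map suc (upTo n)) (lists N n)) l∈)
  with _ , _ , refl ← ∈-map⁻ suc v∈
  with length≡N , positive ← ∈-lists⁻ {N} {n} l'∈
  = cong suc length≡N , s≤s z≤n ∷ positive

parts-≤-sum : ∀ l → All (_≤ sumL l) l
parts-≤-sum []      = []
parts-≤-sum (a ∷ l) = m≤m+n a (sumL l) ∷ All.map (λ v≤ → ≤-trans v≤ (m≤n+m (sumL l) a)) (parts-≤-sum l)

positive-∈-lists : ∀ {l} → All (0 <_) l → l ∈ lists (length l) (sumL l)
positive-∈-lists {l} pos = ∈-lists⁺ (All.zip (pos , parts-≤-sum l))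

_+²_ : ℕ × ℕ → ℕ × ℕ → ℕ × ℕ
(a , b) +² (c , d) = a + c , b + d

+²-cancelʳ : ∀ u v w → u +² w ≡ v +² w → u ≡ v
+²-cancelʳ (a , b) (c , d) (e , f) eq =
  cong₂ _,_ (+-cancelʳ-≡ e a c (cong proj₁ eq)) (+-cancelʳ-≡ f b d (cong proj₂ eq))

onesType : ℕ → ℕ × ℕ
onesType k = altType (replicate k 1)

onesType-mod3 : ∀ N r → onesType (3 * N + r) ≡ onesType r
onesType-mod3 zero    r = refl
onesType-mod3 (suc N) r = trans (cong (λ k → onesType (k + r)) (*-suc 3 N)) (onesType-mod3 N r)

raise : ℕ → List ℕ → List ℕ
raise t μ = map suc (μ ++ replicate t 0)

-- the inverse of raise on weakly decreasing positive lists: it stops at the first part 1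
lower : List ℕ → List ℕ
lower (suc (suc a) ∷ l) = suc a ∷ lower l
lower _                 = []

raise-positive : ∀ t μ → All (0 <_) (raise t μ)
raise-positive t μ = Allₚ.map⁺ (All.universal (λ _ → s≤s z≤n) (μ ++ replicate t 0))

length-++-zeros : ∀ t μ → length (μ ++ replicate t 0) ≡ length μ + t
length-++-zeros t μ = trans (length-++ μ) (cong (_+_ (length μ)) (length-replicate t))

length-raise : ∀ t μ → length (raise t μ) ≡ length μ + t
length-raise t μ = trans (length-map suc (μ ++ replicate t 0)) (length-++-zeros t μ)

sumL-raise : ∀ t μ → sumL (raise t μ) ≡ sumL μ + (length μ + t)
sumL-raise t μ = trans (sumL-map-suc (μ ++ replicate t 0))
  (cong₂ _+_ (trans (sum-++ μ (replicate t 0)) (trans (cong (_+_ (sumL μ)) (sumL-zeros t)) (+-identityʳ _)))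
             (length-++-zeros t μ))
  where
  sumL-map-suc : ∀ l → sumL (map suc l) ≡ sumL l + length l
  sumL-map-suc []      = refl
  sumL-map-suc (a ∷ l) = trans (cong (_+_ (suc a)) (sumL-map-suc l))
    (trans (cong suc (sym (+-assoc a (sumL l) (length l)))) (sym (+-suc (a + sumL l) (length l))))
  sumL-zeros : ∀ t → sumL (replicate t 0) ≡ 0
  sumL-zeros zero    = refl
  sumL-zeros (suc t) = sumL-zeros t

altType-map-suc : ∀ l → altType (map suc l) ≡ altType l +² onesType (length l)
altType-map-suc []              = refl
altType-map-suc (a ∷ [])        = cong (_, 0) (+-comm 1 a)
altType-map-suc (a ∷ b ∷ [])    = cong₂ _,_ (sym (+-identityʳ (a ∸ b))) (+-comm 1 b)
altType-map-suc (a ∷ b ∷ c ∷ l) rewrite altType-map-suc l =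
  cong₂ _,_ (sym (+-assoc (a ∸ b) _ _)) (sym (+-assoc (b ∸ c) _ _))

altType-++-zeros : ∀ t l → altType (l ++ replicate t 0) ≡ altType l
altType-++-zeros zero    l = cong altType (++-identityʳ l)
altType-++-zeros (suc t) l =
  trans (cong altType (sym (++-assoc l [ 0 ] (replicate t 0))))
        (trans (altType-++-zeros t (l ++ [ 0 ])) (altType-∷ʳ-0 l))
  where
  altType-∷ʳ-0 : ∀ l → altType (l ++ [ 0 ]) ≡ altType l
  altType-∷ʳ-0 []              = refl
  altType-∷ʳ-0 (a ∷ [])        = refl
  altType-∷ʳ-0 (a ∷ b ∷ [])    = cong₂ _,_ (+-identityʳ _) (+-identityʳ _)
  altType-∷ʳ-0 (a ∷ b ∷ c ∷ l) rewrite altType-∷ʳ-0 l = refl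

altType-raise : ∀ t μ → altType (raise t μ) ≡ altType μ +² onesType (length μ + t)
altType-raise t μ = trans (altType-map-suc (μ ++ replicate t 0))
  (cong₂ _+²_ (altType-++-zeros t μ) (cong onesType (length-++-zeros t μ)))

nonincr-raise : ∀ t μ → nonincr (raise t μ) ≡ nonincr μ
nonincr-raise t μ = trans (nonincr-map-suc (μ ++ replicate t 0)) (nonincr-++-zeros t μ)
  where
  suc-≤ᵇ-suc : ∀ a b → (suc b ≤ᵇ suc a) ≡ (b ≤ᵇ a)
  suc-≤ᵇ-suc a zero    = refl
  suc-≤ᵇ-suc a (suc b) = refl
  nonincr-map-suc : ∀ l → nonincr (map suc l) ≡ nonincr l
  nonincr-map-suc []          = refl
  nonincr-map-suc (a ∷ [])    = refl
  nonincr-map-suc (a ∷ b ∷ l) = cong₂ _∧_ (suc-≤ᵇ-suc a b) (nonincr-map-suc (b ∷ l))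
  nonincr-zeros : ∀ t → nonincr (replicate t 0) ≡ true
  nonincr-zeros zero          = refl
  nonincr-zeros (suc zero)    = refl
  nonincr-zeros (suc (suc t)) = nonincr-zeros (suc t)
  nonincr-++-zeros : ∀ t l → nonincr (l ++ replicate t 0) ≡ nonincr l
  nonincr-++-zeros t       []          = nonincr-zeros t
  nonincr-++-zeros zero    (a ∷ [])    = refl
  nonincr-++-zeros (suc t) (a ∷ [])    = nonincr-zeros (suc t)
  nonincr-++-zeros t       (a ∷ b ∷ l) = cong ((b ≤ᵇ a) ∧_) (nonincr-++-zeros t (b ∷ l))

atMostTwice-raise : ∀ t {μ} → All (0 <_) μ → atMostTwice (raise t μ) ≡ atMostTwice μ ∧ (t ≤ᵇ 2)
atMostTwice-raise t {μ} pos = trans (atMostTwice-map-suc (μ ++ replicate t 0)) (atMostTwice-++-zeros t pos)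
  where
  atMostTwice-map-suc : ∀ l → atMostTwice (map suc l) ≡ atMostTwice l
  atMostTwice-map-suc []              = refl
  atMostTwice-map-suc (_ ∷ [])        = refl
  atMostTwice-map-suc (_ ∷ _ ∷ [])    = refl
  atMostTwice-map-suc (a ∷ b ∷ c ∷ l) = cong (not ((a ≡ᵇ b) ∧ (b ≡ᵇ c)) ∧_) (atMostTwice-map-suc (b ∷ c ∷ l))
  atMostTwice-zeros : ∀ t → atMostTwice (replicate t 0) ≡ (t ≤ᵇ 2)
  atMostTwice-zeros zero                = refl
  atMostTwice-zeros (suc zero)          = refl
  atMostTwice-zeros (suc (suc zero))    = refl
  atMostTwice-zeros (suc (suc (suc t))) = refl
  -- positivity of μ keeps its last parts distinct from the appended zeros
  atMostTwice-++-zeros : ∀ t {l} → All (0 <_) l → atMostTwice (l ++ replicate t 0) ≡ atMostTwice l ∧ (t ≤ᵇ 2)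
  atMostTwice-++-zeros t             []                   = atMostTwice-zeros t
  atMostTwice-++-zeros zero          (_ ∷ [])             = refl
  atMostTwice-++-zeros (suc zero)    (_ ∷ [])             = refl
  atMostTwice-++-zeros (suc (suc t)) (s≤s _ ∷ [])         = atMostTwice-zeros (suc (suc t))
  atMostTwice-++-zeros zero          (_ ∷ _ ∷ [])         = refl
  atMostTwice-++-zeros (suc t) {a ∷ b ∷ []} (_ ∷ pos@(s≤s _ ∷ [])) =
    cong₂ _∧_ (cong not (∧-zeroʳ (a ≡ᵇ b))) (atMostTwice-++-zeros (suc t) pos)
  atMostTwice-++-zeros t {a ∷ b ∷ c ∷ l} (_ ∷ pos) =
    trans (cong (not ((a ≡ᵇ b) ∧ (b ≡ᵇ c)) ∧_) (atMostTwice-++-zeros t pos))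
          (sym (∧-assoc (not ((a ≡ᵇ b) ∧ (b ≡ᵇ c))) (atMostTwice (b ∷ c ∷ l)) (t ≤ᵇ 2)))

lower-raise : ∀ t {μ} → All (0 <_) μ → lower (raise t μ) ≡ μ
lower-raise zero    []            = refl
lower-raise (suc t) []            = refl
lower-raise t       (s≤s _ ∷ pos) = cong (_ ∷_) (lower-raise t pos)

raise-lower : ∀ {l} → T (nonincr l) → All (0 <_) l →
              raise (length l ∸ length (lower l)) (lower l) ≡ l × All (0 <_) (lower l)
raise-lower {[]}              _  []        = refl , []
raise-lower {suc zero ∷ l}    ni (_ ∷ pos) = cong (1 ∷_) (all-ones ni pos) , []
  where
  all-ones : ∀ {l} → T (nonincr (1 ∷ l)) → All (0 <_) l → map suc (replicate (length l) 0) ≡ l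
  all-ones {[]}             _  []          = refl
  all-ones {suc zero ∷ l}   ni (_ ∷ pos)   = cong (1 ∷_) (all-ones ni pos)
raise-lower {suc (suc a) ∷ l} ni (_ ∷ pos) =
  let raise-lower-l , pos' = raise-lower (nonincr-tail l ni) pos
  in cong (suc (suc a) ∷_) raise-lower-l , s≤s z≤n ∷ pos'
  where
  nonincr-tail : ∀ {a} l → T (nonincr (a ∷ l)) → T (nonincr l)
  nonincr-tail []      _  = _
  nonincr-tail (b ∷ l) ni = proj₂ (Equivalence.to T-∧ ni)

IsGood : ℕ × ℕ → ℕ → List ℕ → Set
IsGood s n l = T (nonincr l) × T (atMostTwice l) × sumL l ≡ n × altType l ≡ s

-- the filter in the definition of aN, so that aN N s₁ s₂ n = count (good? s₁ s₂ n) (lists N n)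
good? : ℕ → ℕ → ℕ → List ℕ → Bool
good? s₁ s₂ n l = nonincr l ∧ atMostTwice l ∧ (sumL l ≡ᵇ n) ∧ (proj₁ (altType l) ≡ᵇ s₁) ∧ (proj₂ (altType l) ≡ᵇ s₂)

T-good? : ∀ s₁ s₂ n l → T (good? s₁ s₂ n l) ⇔ IsGood (s₁ , s₂) n l
T-good? s₁ s₂ n l = mk⇔ to from
  where
  to : T (good? s₁ s₂ n l) → IsGood (s₁ , s₂) n l
  to t =
    let ni , t₁ = Equivalence.to T-∧ t ; amt , t₂ = Equivalence.to T-∧ t₁
        sum≡ , t₃ = Equivalence.to T-∧ t₂ ; s₁≡ , s₂≡ = Equivalence.to T-∧ t₃
    in ni , amt , ≡ᵇ⇒≡ _ n sum≡ , cong₂ _,_ (≡ᵇ⇒≡ _ s₁ s₁≡) (≡ᵇ⇒≡ _ s₂ s₂≡)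
  from : IsGood (s₁ , s₂) n l → T (good? s₁ s₂ n l)
  from (ni , amt , sum≡ , type≡) =
    Equivalence.from T-∧ (ni , Equivalence.from T-∧ (amt , Equivalence.from T-∧ (≡⇒≡ᵇ _ n sum≡ ,
      Equivalence.from T-∧ (≡⇒≡ᵇ _ s₁ (cong proj₁ type≡) , ≡⇒≡ᵇ _ s₂ (cong proj₂ type≡)))))

IsGood-raise : ∀ {s n t μ m} → All (0 <_) μ → length μ + t ≡ m →
               IsGood (s +² onesType m) (n + m) (raise t μ) ⇔ (IsGood s n μ × t ≤ 2)
IsGood-raise {s} {n} {t} {μ} pos refl = mk⇔ to from
  where
  m = length μ + t
  to : IsGood (s +² onesType m) (n + m) (raise t μ) → IsGood s n μ × t ≤ 2
  to (ni , amt , sum≡ , type≡) =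
    let amtμ , t≤ᵇ2 = Equivalence.to T-∧ (subst T (atMostTwice-raise t pos) amt)
    in (subst T (nonincr-raise t μ) ni , amtμ ,
        +-cancelʳ-≡ m (sumL μ) n (trans (sym (sumL-raise t μ)) sum≡) ,
        +²-cancelʳ (altType μ) s (onesType m) (trans (sym (altType-raise t μ)) type≡)) ,
       ≤ᵇ⇒≤ t 2 t≤ᵇ2
  from : IsGood s n μ × t ≤ 2 → IsGood (s +² onesType m) (n + m) (raise t μ)
  from ((ni , amt , sum≡ , type≡) , t≤2) =
    subst T (sym (nonincr-raise t μ)) ni ,
    subst T (sym (atMostTwice-raise t pos)) (Equivalence.from T-∧ (amt , ≤⇒≤ᵇ t≤2)) ,
    trans (sumL-raise t μ) (cong (_+ m) sum≡) ,
    trans (altType-raise t μ) (cong (_+² onesType m) type≡)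

lower-decomposes : ∀ {m n l} → l ∈ lists m n → T (nonincr l) →
                   raise (m ∸ length (lower l)) (lower l) ≡ l × All (0 <_) (lower l) ×
                   length (lower l) + (m ∸ length (lower l)) ≡ m
lower-decomposes {m} {n} {l} l∈ ni with refl , pos ← ∈-lists⁻ {m} {n} l∈ with raise≡ , pos' ← raise-lower ni pos =
  raise≡ , pos' , trans (sym (length-raise _ (lower l))) (cong length raise≡)

Support : ℕ → ℕ → ℕ → ℕ → Set
Support m i j n = (proj₁ (onesType m) , proj₂ (onesType m) , m) ≤³ (i , j , n)

good-support : ∀ {m n i j l} → l ∈ lists m n → IsGood (i , j) n l → Support m i j n
good-support {m} {l = l} l∈ (ni , _ , sum≡ , type≡)
  with raise≡ , _ , length≡ ← lower-decomposes l∈ ni =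
  subst (_ ≤_) (cong proj₁ type≡′) (m≤n+m _ _) , subst (_ ≤_) (cong proj₂ type≡′) (m≤n+m _ _) ,
  subst (m ≤_) sum≡′ (m≤n+m m _)
  where
  μ = lower l
  type≡′ : altType μ +² onesType m ≡ _
  type≡′ = trans (cong (altType μ +²_) (cong onesType (sym length≡)))
                 (trans (sym (altType-raise _ μ)) (trans (cong altType raise≡) type≡))
  sum≡′ : sumL μ + m ≡ _
  sum≡′ = trans (cong (_+_ (sumL μ)) (sym length≡)) (trans (sym (sumL-raise _ μ)) (trans (cong sumL raise≡) sum≡))

length-∈-lists : ∀ {N n l} → l ∈ lists N n → length l ≡ N
length-∈-lists = proj₁ ∘′ ∈-lists⁻

at-own-length : ∀ {N M n μ} → μ ∈ lists N n → N ≤ M → M ∸ N ≤ 2 →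
                μ ∈ lists (length μ) n × length μ ≤ M × M ∸ length μ ≤ 2
at-own-length {M = M} {n} {μ} μ∈ N≤M M∸N≤2 =
  subst (λ k → μ ∈ lists k n × k ≤ M × M ∸ k ≤ 2) (sym (length-∈-lists μ∈)) (μ∈ , N≤M , M∸N≤2)

lists₋₁ : ℕ → ℕ → List (List ℕ)
lists₋₁ zero    n = []
lists₋₁ (suc k) n = lists k n

-- lower maps every partition into suc m₀ parts, each occurring at most twice, into one of these lists
candidates : ℕ → ℕ → List (List ℕ)
candidates m₀ n = lists (suc m₀) n ++ lists m₀ n ++ lists₋₁ m₀ n

count-candidates : ∀ (p : List ℕ → Bool) m₀ n →
                   count p (candidates m₀ n) ≡
                   count p (lists (suc m₀) n) + (count p (lists m₀ n) + count p (lists₋₁ m₀ n))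
count-candidates p m₀ n =
  trans (count-++ p (lists (suc m₀) n) _) (cong (_+_ (count p (lists (suc m₀) n))) (count-++ p (lists m₀ n) _))

candidates-unique : ∀ m₀ n → Unique (candidates m₀ n)
candidates-unique m₀ n =
  Uniqueₚ.++⁺ (lists-unique (suc m₀) n)
              (Uniqueₚ.++⁺ (lists-unique m₀ n) (lists₋₁-unique m₀) (λ (l∈ , l∈') → disjoint₁ l∈ l∈'))
              (λ (l∈ , l∈') → disjoint₀ l∈ l∈')
  where
  lists₋₁-unique : ∀ m₀ → Unique (lists₋₁ m₀ n)
  lists₋₁-unique zero    = []
  lists₋₁-unique (suc k) = lists-unique k n
  length-∈₋₁ : ∀ {m₀ l} → l ∈ lists₋₁ m₀ n → suc (length l) ≡ m₀
  length-∈₋₁ {suc k} l∈ = cong suc (length-∈-lists {k} {n} l∈)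
  disjoint₁ : ∀ {l} → l ∈ lists m₀ n → l ∈ lists₋₁ m₀ n → ⊥
  disjoint₁ l∈ l∈' = 1+n≢n (trans (length-∈₋₁ {m₀} l∈') (sym (length-∈-lists {m₀} {n} l∈)))
  disjoint₀ : ∀ {l} → l ∈ lists (suc m₀) n → l ∈ lists m₀ n ++ lists₋₁ m₀ n → ⊥
  disjoint₀ l∈ l∈' with ∈-++⁻ (lists m₀ n) l∈'
  ... | inj₁ l∈₁ = 1+n≢n (trans (sym (length-∈-lists {suc m₀} {n} l∈)) (length-∈-lists {m₀} {n} l∈₁))
  ... | inj₂ l∈₂ = <⇒≢ (m<n⇒m<1+n (n<1+n m₀))
                       (sym (trans (cong suc (sym (length-∈-lists {suc m₀} {n} l∈))) (length-∈₋₁ {m₀} l∈₂)))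

∈-candidates⁺ : ∀ {m₀ n μ t} → μ ∈ lists (length μ) n → length μ + t ≡ suc m₀ → t ≤ 2 → μ ∈ candidates m₀ n
∈-candidates⁺ {m₀} {n} {μ} {zero} μ∈ length≡ _ =
  ∈-++⁺ˡ (subst (λ k → μ ∈ lists k n) (trans (sym (+-identityʳ _)) length≡) μ∈)
∈-candidates⁺ {m₀} {n} {μ} {suc zero} μ∈ length≡ _ =
  ∈-++⁺ʳ (lists (suc m₀) n) (∈-++⁺ˡ (subst (λ k → μ ∈ lists k n) (suc-injective (trans (+-comm 1 _) length≡)) μ∈))
∈-candidates⁺ {suc m₀} {n} {μ} {suc (suc zero)} μ∈ length≡ _ =
  ∈-++⁺ʳ (lists (suc (suc m₀)) n) (∈-++⁺ʳ (lists (suc m₀) n)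
    (subst (λ k → μ ∈ lists k n) (suc-injective (suc-injective (trans (+-comm 2 _) length≡))) μ∈))
∈-candidates⁺ {zero} {t = suc (suc zero)} _ length≡ _ = contradiction (trans (+-comm 2 _) length≡) λ ()
∈-candidates⁺ {t = suc (suc (suc _))} _ _ (s≤s (s≤s ()))

∈-candidates⁻ : ∀ {m₀ n μ} → μ ∈ candidates m₀ n →
                μ ∈ lists (length μ) n × length μ ≤ suc m₀ × suc m₀ ∸ length μ ≤ 2
∈-candidates⁻ {m₀} {n} μ∈ with ∈-++⁻ (lists (suc m₀) n) μ∈
... | inj₁ μ∈₀ = at-own-length μ∈₀ ≤-refl (≤-trans (≤-reflexive (n∸n≡0 m₀)) z≤n)
... | inj₂ μ∈' with ∈-++⁻ (lists m₀ n) μ∈'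
...   | inj₁ μ∈₁ = at-own-length μ∈₁ (n≤1+n m₀) (≤-trans (≤-reflexive (m+n∸n≡m 1 m₀)) (s≤s z≤n))
∈-candidates⁻ {suc k} {n} μ∈ | inj₂ μ∈' | inj₂ μ∈₂ =
  at-own-length μ∈₂ (≤-trans (n≤1+n k) (n≤1+n (suc k))) (≤-reflexive (m+n∸n≡m 2 k))

module Lift (m₀ : ℕ) {i j n : ℕ} (support : Support (suc m₀) i j n) where

  private
    m  = suc m₀
    i' = i ∸ proj₁ (onesType m)
    j' = j ∸ proj₂ (onesType m)
    n' = n ∸ m

    lift : List ℕ → List ℕ
    lift μ = raise (m ∸ length μ) μ

    unshift : ∀ {l} → IsGood (i , j) n l ⇔ IsGood ((i' , j') +² onesType m) (n' + m) l
    unshift {l} = subst₂ (λ s k → IsGood (i , j) n l ⇔ IsGood s k l) type≡ size≡ (mk⇔ id id)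
      where
      type≡ : (i , j) ≡ (i' , j') +² onesType m
      type≡ = let a≤i , b≤j , _ = support in cong₂ _,_ (sym (m∸n+n≡m a≤i)) (sym (m∸n+n≡m b≤j))
      size≡ : n ≡ n' + m
      size≡ = let _ , _ , m≤n = support in sym (m∸n+n≡m m≤n)

    lower-good : ∀ {l} → l ∈ lists m n → T (good? i j n l) →
                 lower l ∈ candidates m₀ n' × T (good? i' j' n' (lower l)) × lift (lower l) ≡ l
    lower-good {l} l∈ good
      with goodl ← Equivalence.to unshift (Equivalence.to (T-good? i j n l) good)
      with raise≡ , pos , length≡ ← lower-decomposes {m} {n} l∈ (proj₁ goodl)
      with goodμ@(_ , _ , sum≡ , _) , t≤2 ←
             Equivalence.to (IsGood-raise pos length≡) (subst (IsGood _ _) (sym raise≡) goodl)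
      = ∈-candidates⁺ (subst (lower l ∈_) (cong (lists (length (lower l))) sum≡) (positive-∈-lists pos))
                      length≡ t≤2 ,
        Equivalence.from (T-good? i' j' n' (lower l)) goodμ , raise≡

    raise-good : ∀ {μ} → μ ∈ candidates m₀ n' → T (good? i' j' n' μ) →
                 lift μ ∈ lists m n × T (good? i j n (lift μ)) × lower (lift μ) ≡ μ
    raise-good {μ} μ∈ good
      with μ∈′ , length≤ , t≤2 ← ∈-candidates⁻ {m₀} {n'} μ∈
      with _ , pos ← ∈-lists⁻ {length μ} {n'} μ∈′
      with length≡ ← m+[n∸m]≡n length≤
      with goodλ@(_ , _ , sum≡ , _) ← Equivalence.from unshift
             (Equivalence.from (IsGood-raise pos length≡) (Equivalence.to (T-good? i' j' n' μ) good , t≤2))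
      = subst₂ (λ k k' → lift μ ∈ lists k k') (trans (length-raise _ μ) length≡) sum≡
               (positive-∈-lists (raise-positive _ μ)) ,
        Equivalence.from (T-good? i j n (lift μ)) goodλ , lower-raise _ pos

  aN-lift : aN m i j n ≡ aN m i' j' n' + (aN m₀ i' j' n' + count (good? i' j' n') (lists₋₁ m₀ n'))
  aN-lift = trans (count-bijection (good? i j n) (good? i' j' n') lower lift
                     (lists-unique m n) (candidates-unique m₀ n') lower-good raise-good)
                  (count-candidates (good? i' j' n') m₀ n')

aN-vanish : ∀ {m i j n} → ¬ Support m i j n → aN m i j n ≡ 0
aN-vanish {m} {i} {j} {n} ¬support =
  count-none (good? i j n) λ {l} l∈ good → ¬support (good-support l∈ (Equivalence.to (T-good? i j n l) good))

A-as-count : ∀ N i j n → A N i j n ≡ + aN N i j n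
A-as-count zero    zero    zero    zero    = refl
A-as-count zero    zero    zero    (suc n) = refl
A-as-count zero    zero    (suc j) zero    = refl
A-as-count zero    zero    (suc j) (suc n) = refl
A-as-count zero    (suc i) zero    zero    = refl
A-as-count zero    (suc i) zero    (suc n) = refl
A-as-count zero    (suc i) (suc j) zero    = refl
A-as-count zero    (suc i) (suc j) (suc n) = refl
A-as-count (suc N) i       j       zero    = refl
A-as-count (suc N) i       j       (suc n) = refl

-- A (m₀ ∸ 1), with the convention A (-1) = 0
A-prev : ℕ → Series
A-prev zero    _ _ _ = + 0
A-prev (suc k)       = A k

A-prev-as-count : ∀ m₀ i j n → A-prev m₀ i j n ≡ + count (good? i j n) (lists₋₁ m₀ n)
A-prev-as-count zero    i j n = refl
A-prev-as-count (suc k) i j n = A-as-count k i j n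

A-step : ∀ m₀ → let m = suc m₀ ; (a , b) = onesType m in A m ≋ shift a b m (A m ⊕ A m₀ ⊕ A-prev m₀)
A-step m₀ i j n = by-cases ((a , b , m) ≤³? (i , j , n))
  where
  m = suc m₀
  a = proj₁ (onesType m)
  b = proj₂ (onesType m)
  open ≡-Reasoning
  pos-+³ : ∀ x y z → + (x + (y + z)) ≡ + x +ᶻ + y +ᶻ + z
  pos-+³ x y z =
    trans (ℤₚ.pos-+ x (y + z)) (trans (cong (+ x +ᶻ_) (ℤₚ.pos-+ y z)) (sym (ℤₚ.+-assoc (+ x) (+ y) (+ z))))
  by-cases : Dec (Support m i j n) → A m i j n ≡ shift a b m (A m ⊕ A m₀ ⊕ A-prev m₀) i j n
  by-cases (yes support) = begin
    A m i j n ≡⟨ A-as-count m i j n ⟩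
    + aN m i j n ≡⟨ cong +_ (Lift.aN-lift m₀ support) ⟩
    + (aN m i' j' n' + (aN m₀ i' j' n' + count (good? i' j' n') (lists₋₁ m₀ n')))
      ≡⟨ pos-+³ (aN m i' j' n') (aN m₀ i' j' n') (count (good? i' j' n') (lists₋₁ m₀ n')) ⟩
    + aN m i' j' n' +ᶻ + aN m₀ i' j' n' +ᶻ + count (good? i' j' n') (lists₋₁ m₀ n')
      ≡⟨ sym (cong₂ _+ᶻ_ (cong₂ _+ᶻ_ (A-as-count m i' j' n') (A-as-count m₀ i' j' n'))
                         (A-prev-as-count m₀ i' j' n')) ⟩
    (A m ⊕ A m₀ ⊕ A-prev m₀) i' j' n' ≡⟨ sym (shift-inside a b m _ support) ⟩
    shift a b m (A m ⊕ A m₀ ⊕ A-prev m₀) i j n ∎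
    where
    i' = i ∸ a
    j' = j ∸ b
    n' = n ∸ m
  by-cases (no ¬support) = begin
    A m i j n    ≡⟨ A-as-count m i j n ⟩
    + aN m i j n ≡⟨ cong +_ (aN-vanish ¬support) ⟩
    + 0          ≡⟨ sym (shift-outside a b m _ ¬support) ⟩
    shift a b m (A m ⊕ A m₀ ⊕ A-prev m₀) i j n ∎

P-unfold : ∀ m₀ → let m = suc m₀ ; (a , b) = onesType m in
           P m ≋ P m₀ ⊕ shift a b m (A m ⊕ A m₀ ⊕ A-prev m₀)
P-unfold m₀ i j n = cong (P m₀ i j n +ᶻ_) (A-step m₀ i j n)

P₁ : P 1 ≋ geom 1 0 1
P₁ = shift-fixpoint-unique 1 0 0 {Q = one} P₁-unfold (geom-unfold 1 0 0)
  where
  P₁-unfold : P 1 ≋ one ⊕ shift 1 0 1 (P 1)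
  P₁-unfold i j n = trans (P-unfold 0 i j n) (cong (one i j n +ᶻ_) (shift-cong 1 0 1 reorder i j n))
    where
    reorder : A 1 ⊕ A 0 ⊕ A-prev 0 ≋ P 1
    reorder i j n = trans (ℤₚ.+-identityʳ _) (ℤₚ.+-comm (A 1 i j n) (A 0 i j n))

P₂ : P 2 ≋ geom 1 0 1 ⊛ geom 0 1 2
P₂ = shift-fixpoint-unique 0 1 1 {Q = geom 1 0 1} P₂-unfold (⊛-geom-unfold 0 1 1 (geom 1 0 1))
  where
  P₂-unfold : P 2 ≋ geom 1 0 1 ⊕ shift 0 1 2 (P 2)
  P₂-unfold i j n = trans (P-unfold 1 i j n) (cong₂ _+ᶻ_ (P₁ i j n) (shift-cong 0 1 2 reorder i j n))
    where
    reorder : A 2 ⊕ A 1 ⊕ A-prev 1 ≋ P 2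
    reorder i j n = solve 3 (λ a b c → c :+ b :+ a := a :+ b :+ c) refl (A 0 i j n) (A 1 i j n) (A 2 i j n)

P-recurrence : ∀ k → let m = 3 + k ; (a , b) = onesType m in
               P m ≋ P (2 + k) ⊛ geom a b m ⊖ P k ⊛ (mono a b m ⊛ geom a b m)
P-recurrence k = shift-recurrence-solution a b (2 + k) {P (3 + k)} {P (2 + k)} {P k} λ i j n →
  trans (P-unfold (2 + k) i j n) (cong (P (2 + k) i j n +ᶻ_) (shift-cong a b (3 + k) telescope i j n))
  where
  a = proj₁ (onesType (3 + k))
  b = proj₂ (onesType (3 + k))
  telescope : A (3 + k) ⊕ A (2 + k) ⊕ A-prev (2 + k) ≋ P (3 + k) ⊖ P k
  telescope i j n = solve 4 (λ p a b c → c :+ b :+ a := p :+ a :+ b :+ c :- p) refl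
                      (P k i j n) (A (1 + k) i j n) (A (2 + k) i j n) (A (3 + k) i j n)

P-recurrence-at : ∀ m {a b m₁ m₃} → 3 ≤ m → onesType m ≡ (a , b) → m ∸ 1 ≡ m₁ → m ∸ 3 ≡ m₃ →
                  P m ≋ P m₁ ⊛ geom a b m ⊖ P m₃ ⊛ (mono a b m ⊛ geom a b m)
P-recurrence-at (suc (suc (suc k))) (s≤s (s≤s (s≤s _))) type≡ refl refl =
  subst (λ (a , b) → P (3 + k) ≋ P (2 + k) ⊛ geom a b (3 + k) ⊖ P k ⊛ (mono a b (3 + k) ⊛ geom a b (3 + k)))
        type≡ (P-recurrence k)

theorem4p3 :
    (P 0 ≋ one) ×
    (P 1 ≋ geom 1 0 1) ×
    (P 2 ≋ geom 1 0 1 ⊛ geom 0 1 2) ×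
    (∀ (N : ℕ) → 1 ≤ N →
      (P (3 * N) ≋ P (3 * N ∸ 1) ⊛ geom 0 0 (3 * N)
                   ⊖ P (3 * N ∸ 3) ⊛ (mono 0 0 (3 * N) ⊛ geom 0 0 (3 * N))) ×
      (P (3 * N + 1) ≋ P (3 * N) ⊛ geom 1 0 (3 * N + 1)
                   ⊖ P (3 * N ∸ 2) ⊛ (mono 1 0 (3 * N + 1) ⊛ geom 1 0 (3 * N + 1))) ×
      (P (3 * N + 2) ≋ P (3 * N + 1) ⊛ geom 0 1 (3 * N + 2)
                   ⊖ P (3 * N ∸ 1) ⊛ (mono 0 1 (3 * N + 2) ⊛ geom 0 1 (3 * N + 2))))
theorem4p3 = (λ _ _ _ → refl) , P₁ , P₂ , λ N 1≤N →
  let 3≤3N = *-monoʳ-≤ 3 1≤N in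
  P-recurrence-at (3 * N) 3≤3N (trans (cong onesType (sym (+-identityʳ (3 * N)))) (onesType-mod3 N 0)) refl refl ,
  P-recurrence-at (3 * N + 1) (≤-trans 3≤3N (m≤m+n _ 1)) (onesType-mod3 N 1)
    (m+n∸n≡m (3 * N) 1) (trans (sym (∸-+-assoc (3 * N + 1) 1 2)) (cong (_∸ 2) (m+n∸n≡m (3 * N) 1))) ,
  P-recurrence-at (3 * N + 2) (≤-trans 3≤3N (m≤m+n _ 2)) (onesType-mod3 N 2)
    (+-∸-assoc (3 * N) (s≤s z≤n)) (trans (sym (∸-+-assoc (3 * N + 2) 2 1)) (cong (_∸ 1) (m+n∸n≡m (3 * N) 2)))
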